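{- Let $P$ be a normal logic program with $n$ clauses whose heads $a_1,\ldots,a_n$ are pairwise distinct. If the family of stable models of $P$ is exactly $\{\{a_1\},\ldots,\{a_n\}\}$, then $\overline{P}=CP[\{a_1,\ldots,a_n\}]$.
   Context: A (normal) logic program is a finite set of clauses $a\leftarrow b_1,\ldots,b_m,\mathbf{not}(c_1),\ldots,\mathbf{not}(c_k)$ with atoms $a,b_i,c_j$ (bodies regarded as sets of literals). For a set of atoms $M$, the reduct $P^M$ is obtained by deleting every clause whose body contains $\mathbf{not}(c)$ with $c\in M$ and deleting all negative literals from the remaining clauses; $M$ is a stable model of $P$ if $M$ is the least model of $P^M$. An atom occurring in $P$ is redundant if it is not the head of any clause of $P$; $\overline{P}$ is obtained from $P$ by removing all negated occurrences $\mathbf{not}(q)$ of redundant atoms $q$. For $A=\{a_1,\ldots,a_k\}$, $CP[A]$ consists of the clauses $a_i\leftarrow\mathbf{not}(a_1),\ldots,\mathbf{not}(a_{i-1}),\mathbf{not}(a_{i+1}),\ldots,\mathbf{not}(a_k)$, $i=1,\ldots,k$. -}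

module Defs where

open import Data.Nat using (ℕ; _≟_)
open import Data.List using (List; []; [_]; map; filter)
open import Data.List.Relation.Unary.All using (All; all?)
open import Data.List.Relation.Unary.Any using (Any)
open import Data.List.Membership.Propositional using (_∈_; _∉_)
open import Data.List.Membership.DecPropositional _≟_ using (_∈?_)
open import Data.Product using (_×_; Σ; ∃; _,_)
open import Relation.Nullary using (¬_; ¬?)
open import Function using (_⇔_)
open import Relation.Binary.PropositionalEquality using (_≡_)

Atom : Set
Atom = ℕ

-- A normal clause  head ← pos , not(neg)   (bodies regarded as sets).
record Clause : Set where
  constructor _←_,not_
  field
    head : Atom
    pos  : List Atom
    neg  : List Atom
open Clause public

Program : Set
Program = List Clause

record DClause : Set where
  constructor _⇐_
  field
    dhead : Atom
    dpos  : List Atom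
open DClause public

DProgram : Set
DProgram = List DClause

_≋_ : List Atom → List Atom → Set
M ≋ N = ∀ x → (x ∈ M) ⇔ (x ∈ N)

reduct : Program → List Atom → DProgram
reduct P M =
  map (λ c → head c ⇐ pos c)
      (filter (λ c → all? (λ q → ¬? (q ∈? M)) (neg c)) P)

IsModel : DProgram → (Atom → Set) → Set
IsModel Q X = ∀ d → d ∈ Q → All X (dpos d) → X (dhead d)

IsLeastModel : DProgram → List Atom → Set₁
IsLeastModel Q M =
  IsModel Q (_∈ M) × (∀ (X : Atom → Set) → IsModel Q X → ∀ a → a ∈ M → X a)

IsStableModel : Program → List Atom → Set₁
IsStableModel P M = IsLeastModel (reduct P M) M

heads : Program → List Atom
heads P = map head P

-- P̄ : remove not(q) for redundant atoms q (atoms occurring in P that are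
-- not the head of any clause). An atom in a negative body occurs in P, so
-- it is redundant iff it is not a head.
overline : Program → Program
overline P = map (λ c → head c ← pos c ,not filter (_∈? heads P) (neg c)) P

CP : List Atom → Program
CP A = map (λ a → a ← [] ,not filter (λ b → ¬? (b ≟ a)) A) A

_≈C_ : Clause → Clause → Set
c ≈C d = (head c ≡ head d) × (pos c ≋ pos d) × (neg c ≋ neg d)

_≈P_ : Program → Program → Set
P ≈P Q = (∀ c → c ∈ P → Any (c ≈C_) Q) × (∀ d → d ∈ Q → Any (d ≈C_) P)

-- Every singleton {a} with a = head c is stable. Since a lies in the least model of
-- P^{a}, some clause of P^{a} with head a has a body inside {a} that does not use a;
-- as c is the only clause with head a, c must be the fact a ← not(…) with a ∉ neg c.
-- For another head b, the reduct of c w.r.t. {b} would force a ∈ {b} unless b ∈ neg c.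
-- Hence, after dropping the redundant negated atoms, neg c is exactly heads P minus a.
module Submission where

open import Defs
open import Data.Nat using (_≟_)
open import Data.List using (List; []; _∷_; [_]; map; filter)
open import Data.List.Properties using (map-∘)
open import Data.List.Relation.Unary.Any using (Any; here; there)
open import Data.List.Relation.Unary.Any.Properties using (singleton⁻)
open import Data.List.Relation.Unary.All as All using (All; []; _∷_)
open import Data.List.Relation.Unary.AllPairs using (_∷_)
open import Data.List.Relation.Unary.Unique.Propositional using (Unique)
open import Data.List.Membership.Propositional using (_∈_; _∉_; lose)
open import Data.List.Membership.Propositional.Properties
  using (∈-map⁺; ∈-map⁻; ∈-filter⁺; ∈-filter⁻)
open import Data.List.Membership.DecPropositional _≟_ using (_∈?_)
open import Data.Product using (_×_; ∃; _,_; proj₁; proj₂)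
open import Data.Sum using (_⊎_; inj₁; inj₂)
open import Relation.Nullary using (¬?; yes; no; contradiction)
open import Relation.Binary.PropositionalEquality using (_≡_; _≢_; refl; sym; subst)
open import Function using (_∘_; _⇔_; mk⇔; Equivalence)
open import Function.Construct.Identity using (⇔-id)
open import Function.Construct.Symmetry using (⇔-sym)

≋-reflexive : ∀ {xs ys} → xs ≡ ys → xs ≋ ys
≋-reflexive refl _ = ⇔-id _

≋-sym : ∀ {xs ys} → xs ≋ ys → ys ≋ xs
≋-sym xs≋ys x = ⇔-sym (xs≋ys x)

≈C-sym : ∀ {c d} → c ≈C d → d ≈C c
≈C-sym (h , p , n) = sym h , ≋-sym p , ≋-sym n

≈P-map : ∀ {A : Set} (f g : A → Clause) {xs : List A} →
         (∀ {x} → x ∈ xs → f x ≈C g x) → map f xs ≈P map g xs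
≈P-map f g f≈g = to , from
  where
  to : ∀ c → c ∈ map f _ → Any (c ≈C_) (map g _)
  to c c∈ with ∈-map⁻ f c∈
  ... | x , x∈ , refl = lose (∈-map⁺ g x∈) (f≈g x∈)
  from : ∀ d → d ∈ map g _ → Any (d ≈C_) (map f _)
  from d d∈ with ∈-map⁻ g d∈
  ... | x , x∈ , refl = lose (∈-map⁺ f x∈) (≈C-sym (f≈g x∈))

Unique-map⇒injective : ∀ {A B : Set} (f : A → B) {xs : List A} → Unique (map f xs) →
                       ∀ {x y} → x ∈ xs → y ∈ xs → f x ≡ f y → x ≡ y
Unique-map⇒injective f _         (here refl) (here refl) _ = refl
Unique-map⇒injective f (fx∉ ∷ _) (here refl) (there y∈) e = contradiction e (All.lookup fx∉ (∈-map⁺ f y∈))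
Unique-map⇒injective f (fy∉ ∷ _) (there x∈) (here refl) e = contradiction (sym e) (All.lookup fy∉ (∈-map⁺ f x∈))
Unique-map⇒injective f (_ ∷ u)   (there x∈) (there y∈) e = Unique-map⇒injective f u x∈ y∈ e

∈-reduct⁺ : ∀ {P M c} → c ∈ P → All (_∉ M) (neg c) → (head c ⇐ pos c) ∈ reduct P M
∈-reduct⁺ {M = M} c∈ negc∩M≡∅ =
  ∈-map⁺ _ (∈-filter⁺ (λ c → All.all? (λ q → ¬? (q ∈? M)) (neg c)) c∈ negc∩M≡∅)

∈-reduct⁻ : ∀ {P M d} → d ∈ reduct P M →
            ∃ λ c → c ∈ P × All (_∉ M) (neg c) × d ≡ (head c ⇐ pos c)
∈-reduct⁻ {M = M} d∈ with ∈-map⁻ _ d∈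
... | c , c∈filter , d≡ with ∈-filter⁻ (λ c → All.all? (λ q → ¬? (q ∈? M)) (neg c)) c∈filter
...   | c∈ , negc∩M≡∅ = c , c∈ , negc∩M≡∅ , d≡

Supported : DProgram → List Atom → Atom → Set
Supported Q M a = ∃ λ d → d ∈ Q × dhead d ≡ a × All (λ b → b ∈ M × b ≢ a) (dpos d)

-- Least-model induction with the invariant "b ∈ M, and if b is a then a is supported".
leastModel⇒supported : ∀ {Q M a} → IsLeastModel Q M → a ∈ M → Supported Q M a
leastModel⇒supported {Q} {M} {a} (M-model , M-least) a∈M =
  proj₂ (M-least X X-model a a∈M) refl
  where
  X : Atom → Set
  X b = b ∈ M × (b ≡ a → Supported Q M a)

  avoids-a-or-supported : ∀ bs → All X bs → All (λ b → b ∈ M × b ≢ a) bs ⊎ Supported Q M a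
  avoids-a-or-supported []       []                 = inj₁ []
  avoids-a-or-supported (b ∷ bs) ((b∈M , sup) ∷ Xbs) with b ≟ a
  ... | yes b≡a = inj₂ (sup b≡a)
  ... | no  b≢a with avoids-a-or-supported bs Xbs
  ...   | inj₁ avoid = inj₁ ((b∈M , b≢a) ∷ avoid)
  ...   | inj₂ s     = inj₂ s

  X-model : IsModel Q X
  X-model d d∈ Xbody = M-model d d∈ (All.map proj₁ Xbody) , supported
    where
    supported : dhead d ≡ a → Supported Q M a
    supported h≡a with avoids-a-or-supported (dpos d) Xbody
    ... | inj₁ avoid = d , d∈ , h≡a , avoid
    ... | inj₂ s     = s

stable⇒closed : ∀ {P M c} → IsStableModel P M → c ∈ P →
                All (_∈ M) (pos c) → All (_∉ M) (neg c) → head c ∈ M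
stable⇒closed (M-model , _) c∈ pos⊆M negc∩M≡∅ = M-model _ (∈-reduct⁺ c∈ negc∩M≡∅) pos⊆M

stable⇒supported : ∀ {P M a} → IsStableModel P M → a ∈ M →
                   ∃ λ c → c ∈ P × head c ≡ a × All (λ b → b ∈ M × b ≢ a) (pos c)
                                               × All (_∉ M) (neg c)
stable⇒supported stable a∈M with leastModel⇒supported stable a∈M
... | d , d∈ , h≡a , avoid with ∈-reduct⁻ d∈
...   | c , c∈ , negc∩M≡∅ , refl = c , c∈ , h≡a , avoid , negc∩M≡∅

avoiding-singleton⇒[] : ∀ {a : Atom} {bs} → All (λ b → b ∈ [ a ] × b ≢ a) bs → bs ≡ []
avoiding-singleton⇒[] []                        = refl
avoiding-singleton⇒[] ((here b≡a , b≢a) ∷ _) = contradiction b≡a b≢a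

module _ (P : Program) (heads-unique : Unique (heads P))
         (stable⇔singleton : ∀ M → IsStableModel P M ⇔ Any (λ a → M ≋ [ a ]) (heads P)) where

  singleton-stable : ∀ {c} → c ∈ P → IsStableModel P [ head c ]
  singleton-stable {c} c∈ =
    Equivalence.from (stable⇔singleton [ head c ])
      (lose (∈-map⁺ head c∈) (≋-reflexive refl))

  clause-is-fact : ∀ {c} → c ∈ P → pos c ≡ [] × head c ∉ neg c
  clause-is-fact {c} c∈ with stable⇒supported (singleton-stable c∈) (here refl)
  ... | c′ , c′∈ , h≡ , avoid , negc′∩a≡∅
    with Unique-map⇒injective head heads-unique c′∈ c∈ h≡
  ...   | refl = avoiding-singleton⇒[] avoid , λ a∈ → All.lookup negc′∩a≡∅ a∈ (here refl)

  other-head∈neg : ∀ {c c′} → c ∈ P → c′ ∈ P → head c′ ≢ head c → head c′ ∈ neg c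
  other-head∈neg {c} {c′} c∈ c′∈ h′≢h with head c′ ∈? neg c
  ... | yes h′∈ = h′∈
  ... | no  h′∉ =
    contradiction (singleton⁻ (stable⇒closed (singleton-stable c′∈) c∈ pos⊆ negc∩h′≡∅)) (h′≢h ∘ sym)
    where
    pos⊆ : All (_∈ [ head c′ ]) (pos c)
    pos⊆ = subst (All (_∈ [ head c′ ])) (sym (proj₁ (clause-is-fact c∈))) []
    negc∩h′≡∅ : All (_∉ [ head c′ ]) (neg c)
    negc∩h′≡∅ = All.tabulate λ { x∈ (here refl) → h′∉ x∈ }

  overline-neg≋CP-neg : ∀ {c} → c ∈ P →
    filter (_∈? heads P) (neg c) ≋ filter (λ b → ¬? (b ≟ head c)) (heads P)
  overline-neg≋CP-neg {c} c∈ x = mk⇔ to from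
    where
    to : x ∈ filter (_∈? heads P) (neg c) → x ∈ filter (λ b → ¬? (b ≟ head c)) (heads P)
    to x∈ with ∈-filter⁻ (_∈? heads P) x∈
    ... | x∈neg , x∈heads = ∈-filter⁺ (λ b → ¬? (b ≟ head c)) x∈heads
                              λ { refl → proj₂ (clause-is-fact c∈) x∈neg }
    from : x ∈ filter (λ b → ¬? (b ≟ head c)) (heads P) → x ∈ filter (_∈? heads P) (neg c)
    from x∈ with ∈-filter⁻ (λ b → ¬? (b ≟ head c)) x∈
    ... | x∈heads , x≢h with ∈-map⁻ head x∈heads
    ...   | c′ , c′∈ , refl = ∈-filter⁺ (_∈? heads P) (other-head∈neg c∈ c′∈ x≢h) x∈heads

  overline-clause : Clause → Clause
  overline-clause c = head c ← pos c ,not filter (_∈? heads P) (neg c)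

  CP-clause : Atom → Clause
  CP-clause a = a ← [] ,not filter (λ b → ¬? (b ≟ a)) (heads P)

  overline-clause≈CP-clause : ∀ {c} → c ∈ P → overline-clause c ≈C CP-clause (head c)
  overline-clause≈CP-clause c∈ =
    refl , ≋-reflexive (proj₁ (clause-is-fact c∈)) , overline-neg≋CP-neg c∈

  overline≈CP : overline P ≈P CP (heads P)
  overline≈CP = subst (overline P ≈P_) (map-∘ P)
    (≈P-map overline-clause (CP-clause ∘ head) overline-clause≈CP-clause)

lemma13 : (P : Program) → Unique (heads P)
    → (∀ (M : List Atom) → IsStableModel P M ⇔ Any (λ a → M ≋ [ a ]) (heads P))
    → overline P ≈P CP (heads P)
lemma13 = overline≈CP
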